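{- Let $F=(\mathit{Args},\rightsquigarrow)$ be a $k$-SETAF. Then an argument $\alpha$ is in the grounded extension of $F$ if and only if $\mathtt{acc}(\alpha)$ belongs to (is true in) the well-founded model of the normal logic program $$\{\mathtt{def}(x)\leftarrow\mathtt{att}_i(y_1,\dots,y_i,x),\mathtt{acc}(y_1),\dots,\mathtt{acc}(y_i)\mid 1\le i\le k\}\cup\{\mathtt{acc}(x)\leftarrow\mathtt{arg}(x),\neg\mathtt{def}(x)\}\cup\{\mathtt{arg}(\alpha)\mid\alpha\in\mathit{Args}\}\cup\{\mathtt{att}_i(\alpha_1,\dots,\alpha_i,\beta)\leftarrow\ \mid\{\alpha_1,\dots,\alpha_i\}\rightsquigarrow\beta\}.$$
   Context: A SETAF is $(\mathit{Args},\rightsquigarrow)$ with $\mathit{Args}$ finite and $\rightsquigarrow\subseteq(2^{\mathit{Args}}\setminus\{\emptyset\})\times\mathit{Args}$; it is a $k$-SETAF if $S\rightsquigarrow\beta$ implies $|S|\le k$. $S^+=\{\alpha\mid\exists T\subseteq S,T\rightsquigarrow\alpha\}$, $\Gamma(S)=\{\alpha\mid\forall T\rightsquigarrow\alpha,\ T\cap S^+\neq\emptyset\}$, and the grounded extension is the least fixpoint of $\Gamma$. Normal logic programs consist of rules $h\leftarrow b_1,\dots,b_n,\neg b_{n+1},\dots,\neg b_{n+m}$. Well-founded semantics: for a ground program $\Pi$ and a set of ground atoms $I$, $\Pi|_I$ is the definite program obtained by deleting every rule with some $\neg a$ in its body where $a\in I$ and removing the negative literals from the remaining rules; set $I_0=\emptyset$,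 $I_{j+1}$ = minimal model of $\Pi|_{I_j}$; the even-indexed sequence increases to a limit $I_*$ and the odd one decreases to $I^*$; the well-founded model makes atoms of $I_*$ true, atoms not in $I^*$ false, and the others unknown. For a non-ground program, use its grounding over its constants. -}

module Defs where

open import Data.Nat using (ℕ; zero; suc; _≤_; _*_)
open import Data.Fin using (Fin; zero; suc)
open import Data.Fin.Subset using (Subset; Nonempty; ∣_∣) renaming (_∈_ to _∈ₛ_)
open import Data.Bool using (Bool; true; false)
open import Data.Vec using (lookup)
open import Data.List using (List; []; _∷_; map; _++_; filter; length; upTo; allFin)
open import Data.List.Membership.Propositional using (_∈_)
open import Data.List.Relation.Unary.All using (All)
open import Data.Product using (Σ; ∃; _×_; _,_)
open import Data.Empty using (⊥)
open import Relation.Nullary using (¬_)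
open import Relation.Binary.PropositionalEquality using (_≡_; refl)
open import Relation.Nullary.Decidable using (yes; no)
open import Data.Bool.Properties using () renaming (_≟_ to _≟B_)

-- SETAFs over the finite argument set Args = Fin n.
-- The attack relation ⇝ is given as a finite list of pairs (S , β),
-- meaning S ⇝ β.

record SETAF (n : ℕ) : Set where
  field
    attacks  : List (Subset n × Fin n)
    nonempty : ∀ {S β} → (S , β) ∈ attacks → Nonempty S

open SETAF public

_⇝_within_ : ∀ {n} → Subset n → Fin n → SETAF n → Set
S ⇝ β within F = (S , β) ∈ attacks F

IsKSETAF : ∀ {n} → ℕ → SETAF n → Set
IsKSETAF k F = ∀ {S β} → S ⇝ β within F → ∣ S ∣ ≤ k

ArgSet : ℕ → Set₁
ArgSet n = Fin n → Set

module _ {n : ℕ} (F : SETAF n) where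

  plus : ArgSet n → ArgSet n
  plus S α = Σ (Subset n) λ T → (T ⇝ α within F) × (∀ x → x ∈ₛ T → S x)

  Γ : ArgSet n → ArgSet n
  Γ S α = ∀ T → T ⇝ α within F → ∃ λ x → (x ∈ₛ T) × plus S x

  IsGroundedExt : ArgSet n → Set₁
  IsGroundedExt G =
    (∀ α → Γ G α → G α) × (∀ α → G α → Γ G α) ×
    (∀ (H : ArgSet n) → (∀ α → Γ H α → H α) → (∀ α → H α → Γ H α) →
       ∀ α → G α → H α)

module LP (P C : Set) where

  data Term (v : ℕ) : Set where
    var : Fin v → Term v
    con : C → Term v

  Atom : ℕ → Set
  Atom v = P × List (Term v)

  record Rule : Set where
    constructor rule
    field
      vars : ℕ
      head : Atom vars
      pos  : List (Atom vars)
      neg  : List (Atom vars)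

  Program : Set
  Program = List Rule

  GAtom : Set
  GAtom = P × List C

  record GRule : Set where
    constructor grule
    field
      ghead : GAtom
      gpos  : List GAtom
      gneg  : List GAtom

  substT : ∀ {v} → (Fin v → C) → Term v → C
  substT σ (var x) = σ x
  substT σ (con c) = c

  substA : ∀ {v} → (Fin v → C) → Atom v → GAtom
  substA σ (p , ts) = p , map (substT σ) ts

  instRule : (R : Rule) → (Fin (Rule.vars R) → C) → GRule
  instRule (rule v h ps ns) σ = grule (substA σ h) (map (substA σ) ps) (map (substA σ) ns)

  InGround : Program → GRule → Set
  InGround Π r = Σ Rule λ R → (R ∈ Π) × Σ (Fin (Rule.vars R) → C) λ σ → instRule R σ ≡ r

  -- Π|_I : definite rules (head , positive body)
  Reduct : Program → (GAtom → Set) → GAtom × List GAtom → Set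
  Reduct Π I (h , body) = Σ GRule λ r → InGround Π r ×
    All (λ a → ¬ I a) (GRule.gneg r) × (GRule.ghead r ≡ h) × (GRule.gpos r ≡ body)

  data MinModel (D : GAtom × List GAtom → Set) : GAtom → Set where
    derive : ∀ {h body} → D (h , body) → All (MinModel D) body → MinModel D h

  Iseq : Program → ℕ → GAtom → Set
  Iseq Π zero    a = ⊥
  Iseq Π (suc j) a = MinModel (Reduct Π (Iseq Π j)) a

  WFTrue : Program → GAtom → Set
  WFTrue Π a = ∃ λ j → Iseq Π (2 * j) a

data Sym : Set where
  def acc arg : Sym
  att : ℕ → Sym

elems : ∀ {n} → Subset n → List (Fin n)
elems S = filter (λ x → lookup S x ≟B true) (allFin _)

module _ {n : ℕ} (k : ℕ) (F : SETAF n) where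
  open LP Sym (Fin n)

  -- def(x) ← att_i(y₁,…,yᵢ,x), acc(y₁),…,acc(yᵢ)   (x = var zero, y_j = var (suc j))
  defRule : ℕ → Rule
  defRule i = rule (suc i) (def , var zero ∷ [])
    ((att i , map (λ j → var (suc j)) (allFin i) ++ (var zero ∷ []))
      ∷ map (λ j → (acc , var (suc j) ∷ [])) (allFin i))
    []

  accRule : Rule
  accRule = rule 1 (acc , var zero ∷ []) ((arg , var zero ∷ []) ∷ []) ((def , var zero ∷ []) ∷ [])

  fact : Atom 0 → Rule
  fact a = rule 0 a [] []

  argFact : Fin n → Rule
  argFact α = fact (arg , con α ∷ [])

  attFact : Subset n × Fin n → Rule
  attFact (S , β) = fact (att (length (elems S)) , map con (elems S) ++ (con β ∷ []))

  setafProgram : Program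
  setafProgram = map (λ i → defRule (suc i)) (upTo k) ++ (accRule ∷ [])
    ++ map argFact (allFin n) ++ map attFact (attacks F)

module Submission where

-- Argumentation side: Γ is monotone, and because F is finite it is also
-- ω-continuous on increasing chains.  Hence the least fixpoint of Γ is the
-- union of the Kleene iterates Γ⁰(∅) ⊆ Γ¹(∅) ⊆ …  (grounded-as-iterates).
--
-- Program side: we first read off, for an arbitrary interpretation I, which
-- atoms the minimal model of the reduct Π|_I contains: att-atoms are exactly
-- the attacks, acc(x) holds iff def(x) ∉ I, and def(x) holds iff x is
-- attacked by a set of arguments all accepted in the model.  Writing
-- Acc j / Def j for the acc- / def-atoms of I_j this gives
--   Def j = (Acc j)⁺   and   Acc (j+2) = Γ (Acc j),
-- where the second step uses that every Def j is decidable.  Thus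
-- Acc (2j) = Γʲ(∅), and the theorem follows by comparing the two unions.

open import Defs
open import Data.Nat using (ℕ)
open import Data.Fin using (Fin)
open import Data.List using (_∷_; [])
open import Data.Product using (_,_)
open import Function.Bundles using (_⇔_)

open import Data.Nat using (zero; suc; _≤_; _≤′_; ≤′-refl; ≤′-step; _<_; _*_; _⊔_)
open import Data.Nat.Properties using (*-suc; m≤m⊔n; m≤n⊔m; ≤⇒≤′)
open import Data.Fin using (zero; suc) renaming (_≟_ to _≟F_)
open import Data.Fin.Subset using (Subset; ∣_∣) renaming (_∈_ to _∈ₛ_)
open import Data.Fin.Subset.Properties using (_∈?_)
open import Data.Fin.Properties using (any?; all?)
open import Data.Bool using (true; false)
open import Data.Bool.Properties using () renaming (_≟_ to _≟B_)
open import Data.Vec using () renaming (lookup to vlookup; _∷_ to _∷ᵥ_; [] to []ᵥ)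
open import Data.Vec.Properties using ([]=⇒lookup; lookup⇒[]=)
open import Data.List using (List; map; _++_; filter; length; allFin; tabulate; upTo)
  renaming (lookup to llookup)
open import Data.List.Properties using (map-++; map-∘; map-id; ∷ʳ-injective; map-tabulate; tabulate-lookup)
open import Data.List.Membership.Propositional using (_∈_; find; lose)
open import Data.List.Membership.Propositional.Properties
  using (∈-map⁺; ∈-map⁻; ∈-++⁺ˡ; ∈-++⁺ʳ; ∈-++⁻; ∈-filter⁺; ∈-filter⁻; ∈-allFin; ∈-upTo⁺; ∉[])
open import Data.List.Relation.Unary.All as All using (All; []; _∷_)
import Data.List.Relation.Unary.All.Properties as AllP
open import Data.List.Relation.Unary.Any using (Any; here; there) renaming (any? to anyₗ?)
open import Data.Product using (Σ; ∃; _×_; proj₁; proj₂)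
open import Data.Sum using (inj₁; inj₂)
open import Data.Empty using (⊥; ⊥-elim)
open import Function using (_∘_)
open import Function.Bundles using (mk⇔; Equivalence)
import Function.Properties.Equivalence as ⇔
open import Relation.Nullary using (¬_; yes; no)
open import Relation.Nullary.Decidable using (map′; ¬?; _×-dec_; _→-dec_)
import Relation.Nullary.Decidable as Dec
open import Relation.Unary using (Decidable)
open import Relation.Binary.PropositionalEquality using (_≡_; refl; sym; trans; cong; subst)

open Equivalence using (to; from)

Monotone : {X : Set} → (ℕ → X → Set) → Set
Monotone Q = ∀ {j j'} → j ≤ j' → ∀ x → Q j x → Q j' x

increasing⇒monotone : {X : Set} (Q : ℕ → X → Set) → (∀ j x → Q j x → Q (suc j) x) → Monotone Q
increasing⇒monotone Q step le = go (≤⇒≤′ le)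
  where
  go : ∀ {j j'} → j ≤′ j' → ∀ x → Q j x → Q j' x
  go ≤′-refl       x q = q
  go (≤′-step le′) x q = step _ x (go le′ x q)

common-stage : {X : Set} (Q : ℕ → X → Set) → Monotone Q → (xs : List X) →
  (∀ x → x ∈ xs → ∃ λ j → Q j x) → ∃ λ j → ∀ x → x ∈ xs → Q j x
common-stage Q mono []       h = 0 , λ _ ()
common-stage Q mono (y ∷ xs) h
  with j₀ , q₀ ← h y (here refl)
     | j₁ , q₁ ← common-stage Q mono xs (λ x x∈ → h x (there x∈)) =
  j₀ ⊔ j₁ , λ { x (here refl) → mono (m≤m⊔n j₀ j₁) x q₀
              ; x (there x∈)  → mono (m≤n⊔m j₀ j₁) x (q₁ x x∈) }

∈ₛ⇒∈elems : ∀ {n} {z : Fin n} {T : Subset n} → z ∈ₛ T → z ∈ elems T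
∈ₛ⇒∈elems {z = z} {T} z∈ = ∈-filter⁺ (λ x → vlookup T x ≟B true) (∈-allFin z) ([]=⇒lookup z∈)

∈elems⇒∈ₛ : ∀ {n} {z : Fin n} {T : Subset n} → z ∈ elems T → z ∈ₛ T
∈elems⇒∈ₛ {n} {z} {T} z∈ =
  lookup⇒[]= z T (proj₂ (∈-filter⁻ (λ x → vlookup T x ≟B true) {xs = allFin n} z∈))

length-filter-tabulate : ∀ {m} {A : Set} {P : A → Set} (P? : Decidable P) (f : Fin m → A) (S : Subset m) →
  (∀ i → P (f i) → vlookup S i ≡ true) → (∀ i → vlookup S i ≡ true → P (f i)) →
  length (filter P? (tabulate f)) ≡ ∣ S ∣
length-filter-tabulate P? f []ᵥ _ _ = refl
length-filter-tabulate P? f (b ∷ᵥ S) sound complete with P? (f zero) | b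
... | yes p | true  = cong suc (length-filter-tabulate P? (f ∘ suc) S (sound ∘ suc) (complete ∘ suc))
... | yes p | false with () ← sound zero p
... | no ¬p | true  = ⊥-elim (¬p (complete zero refl))
... | no ¬p | false = length-filter-tabulate P? (f ∘ suc) S (sound ∘ suc) (complete ∘ suc)

length-elems : ∀ {n} (T : Subset n) → length (elems T) ≡ ∣ T ∣
length-elems T = length-filter-tabulate (λ x → vlookup T x ≟B true) (λ x → x) T (λ _ p → p) (λ _ p → p)

module Grounded {n : ℕ} (F : SETAF n) where

  infix 4 _⊆_
  _⊆_ : ArgSet n → ArgSet n → Set
  S ⊆ S' = ∀ x → S x → S' x

  ⋃ : (ℕ → ArgSet n) → ArgSet n
  ⋃ C α = ∃ λ j → C j α

  plus-mono : ∀ {S S'} → S ⊆ S' → plus F S ⊆ plus F S'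
  plus-mono S⊆S' x (T , T⇝x , T⊆S) = T , T⇝x , λ w w∈T → S⊆S' w (T⊆S w w∈T)

  Γ-mono : ∀ {S S'} → S ⊆ S' → Γ F S ⊆ Γ F S'
  Γ-mono S⊆S' α γ T T⇝α with x , x∈T , x∈S⁺ ← γ T T⇝α = x , x∈T , plus-mono S⊆S' x x∈S⁺

  Γ-cong : ∀ {S S'} → (∀ x → S x ⇔ S' x) → ∀ α → Γ F S α ⇔ Γ F S' α
  Γ-cong S≐S' α = mk⇔ (Γ-mono (λ x → to (S≐S' x)) α) (Γ-mono (λ x → from (S≐S' x)) α)

  -- S⁺ is decidable whenever S is: search the finite list of attacks.
  plus? : ∀ {S} → Decidable S → Decidable (plus F S)
  plus? {S} S? x =
    map′ fromAny toAny
      (anyₗ? (λ e → (proj₂ e ≟F x) ×-dec all? (λ z → z ∈? proj₁ e →-dec S? z)) (attacks F))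
    where
    AttackFrom : Subset n × Fin n → Set
    AttackFrom (T , β) = β ≡ x × (∀ z → z ∈ₛ T → S z)
    fromAny : Any AttackFrom (attacks F) → plus F S x
    fromAny a with (T , β) , e∈ , refl , T⊆S ← find a = T , e∈ , T⊆S
    toAny : plus F S x → Any AttackFrom (attacks F)
    toAny (T , T⇝x , T⊆S) = lose T⇝x (refl , T⊆S)

  -- Finiteness of F: an attacker set inside a union of a chain lies inside one of its stages.
  plus-continuous : ∀ (C : ℕ → ArgSet n) → Monotone C → ∀ x → plus F (⋃ C) x → ∃ λ j → plus F (C j) x
  plus-continuous C mono x (T , T⇝x , T⊆⋃C)
    with j , T⊆Cj ← common-stage C mono (elems T) (λ z z∈ → T⊆⋃C z (∈elems⇒∈ₛ z∈)) =
    j , T , T⇝x , λ z z∈T → T⊆Cj z (∈ₛ⇒∈elems z∈T)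

  -- Γ is ω-continuous on increasing chains, again because F has finitely many attacks.
  Γ-continuous : ∀ (C : ℕ → ArgSet n) → Monotone C → Γ F (⋃ C) ⊆ ⋃ (λ j → Γ F (C j))
  Γ-continuous C mono α γ =
    let j , defended = common-stage Defended Defended-mono (attacks F) counter
    in  j , λ T T⇝α → defended (T , α) T⇝α refl
    where
    Defended : ℕ → Subset n × Fin n → Set
    Defended j (T , β) = β ≡ α → ∃ λ x → (x ∈ₛ T) × plus F (C j) x
    Defended-mono : Monotone Defended
    Defended-mono le (T , β) d β≡α with x , x∈T , p ← d β≡α = x , x∈T , plus-mono (mono le) x p
    counter : ∀ e → e ∈ attacks F → ∃ λ j → Defended j e
    counter (T , β) e∈ with β ≟F α
    ... | no β≢α = 0 , λ β≡α → ⊥-elim (β≢α β≡α)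
    ... | yes refl =
      let x , x∈T , x∈⋃C⁺ = γ T e∈
          j , x∈Cj⁺       = plus-continuous C mono x x∈⋃C⁺
      in  j , λ _ → x , x∈T , x∈Cj⁺

  Γ^ : ℕ → ArgSet n
  Γ^ zero    _ = ⊥
  Γ^ (suc j) = Γ F (Γ^ j)

  Γ^-increasing : ∀ j → Γ^ j ⊆ Γ^ (suc j)
  Γ^-increasing zero    _ ()
  Γ^-increasing (suc j) = Γ-mono (Γ^-increasing j)

  Γ^⊆prefixpoint : ∀ {H} → Γ F H ⊆ H → ∀ j → Γ^ j ⊆ H
  Γ^⊆prefixpoint ΓH⊆H zero    _ ()
  Γ^⊆prefixpoint ΓH⊆H (suc j) α γ = ΓH⊆H α (Γ-mono (Γ^⊆prefixpoint ΓH⊆H j) α γ)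

  ⋃Γ^-postfixpoint : ⋃ Γ^ ⊆ Γ F (⋃ Γ^)
  ⋃Γ^-postfixpoint α (zero  , ())
  ⋃Γ^-postfixpoint α (suc j , γ) = Γ-mono (λ x x∈ → j , x∈) α γ

  ⋃Γ^-prefixpoint : Γ F (⋃ Γ^) ⊆ ⋃ Γ^
  ⋃Γ^-prefixpoint α γ
    with j , γj ← Γ-continuous Γ^ (increasing⇒monotone Γ^ Γ^-increasing) α γ = suc j , γj

  grounded-as-iterates : ∀ {G} → IsGroundedExt F G → ∀ α → G α ⇔ ⋃ Γ^ α
  grounded-as-iterates (ΓG⊆G , _ , least) α = mk⇔
    (least (⋃ Γ^) ⋃Γ^-prefixpoint ⋃Γ^-postfixpoint α)
    (λ (j , γ) → Γ^⊆prefixpoint ΓG⊆G j α γ)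

module Encoding {n : ℕ} (k : ℕ) (F : SETAF n) (kF : IsKSETAF k F) where
  open LP Sym (Fin n)
  open Grounded F

  Π : Program
  Π = setafProgram k F

  data Schema (R : Rule) : Set where
    defSchema : ∀ i → R ≡ defRule k F (suc i) → Schema R
    accSchema : R ≡ accRule k F → Schema R
    argSchema : ∀ α → R ≡ argFact k F α → Schema R
    attSchema : ∀ e → e ∈ attacks F → R ≡ attFact k F e → Schema R

  schema : ∀ {R} → R ∈ Π → Schema R
  schema R∈ with ∈-++⁻ (map (λ i → defRule k F (suc i)) (upTo k)) R∈
  ... | inj₁ R∈defs with i , _ , refl ← ∈-map⁻ (λ i → defRule k F (suc i)) R∈defs = defSchema i refl
  ... | inj₂ (here refl) = accSchema refl
  ... | inj₂ (there R∈facts) with ∈-++⁻ (map (argFact k F) (allFin n)) R∈facts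
  ...   | inj₁ R∈args with α , _ , refl ← ∈-map⁻ (argFact k F) R∈args = argSchema α refl
  ...   | inj₂ R∈atts with e , e∈ , refl ← ∈-map⁻ (attFact k F) R∈atts = attSchema e e∈ refl

  defRule∈Π : ∀ {i} → i < k → defRule k F (suc i) ∈ Π
  defRule∈Π i<k = ∈-++⁺ˡ (∈-map⁺ (λ i → defRule k F (suc i)) (∈-upTo⁺ i<k))

  accRule∈Π : accRule k F ∈ Π
  accRule∈Π = ∈-++⁺ʳ (map (λ i → defRule k F (suc i)) (upTo k)) (here refl)

  argFact∈Π : ∀ α → argFact k F α ∈ Π
  argFact∈Π α = ∈-++⁺ʳ (map (λ i → defRule k F (suc i)) (upTo k))
    (∈-++⁺ʳ (accRule k F ∷ []) (∈-++⁺ˡ (∈-map⁺ (argFact k F) (∈-allFin α))))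

  attFact∈Π : ∀ {e} → e ∈ attacks F → attFact k F e ∈ Π
  attFact∈Π e∈ = ∈-++⁺ʳ (map (λ i → defRule k F (suc i)) (upTo k))
    (∈-++⁺ʳ (accRule k F ∷ []) (∈-++⁺ʳ (map (argFact k F) (allFin n)) (∈-map⁺ (attFact k F) e∈)))

  attPremise : (i : ℕ) → Atom (suc i)
  attPremise i = att i , map (λ j → var (suc j)) (allFin i) ++ var zero ∷ []

  accPremises : (i : ℕ) → List (Atom (suc i))
  accPremises i = map (λ j → acc , var (suc j) ∷ []) (allFin i)

  attPremise-inst : ∀ {i} (σ : Fin (suc i) → Fin n) →
    substA σ (attPremise i) ≡ (att i , map (σ ∘ suc) (allFin i) ++ σ zero ∷ [])
  attPremise-inst {i} σ = cong (att i ,_)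
    (trans (map-++ (substT σ) (map (λ j → var (suc j)) (allFin i)) (var zero ∷ []))
           (cong (_++ σ zero ∷ []) (sym (map-∘ (allFin i)))))

  attFact-inst : ∀ (σ : Fin 0 → Fin n) (ys : List (Fin n)) β →
    substA σ (att (length ys) , map con ys ++ con β ∷ []) ≡ (att (length ys) , ys ++ β ∷ [])
  attFact-inst σ ys β = cong (att (length ys) ,_)
    (trans (map-++ (substT σ) (map con ys) (con β ∷ []))
           (cong (_++ β ∷ []) (trans (sym (map-∘ ys)) (map-id ys))))

  M : (GAtom → Set) → GAtom → Set
  M I = MinModel (Reduct Π I)

  AccIn : (GAtom → Set) → ArgSet n
  AccIn I x = M I (acc , x ∷ [])

  att⇒attack : ∀ {I m ys x} → M I (att m , ys ++ x ∷ []) →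
    Σ (Subset n) λ S → (S , x) ∈ attacks F × elems S ≡ ys
  att⇒attack (derive (_ , (_ , R∈ , _) , _) _) with schema R∈
  att⇒attack (derive (_ , (_ , _ , _ , refl) , _ , () , _) _) | defSchema _ refl
  att⇒attack (derive (_ , (_ , _ , _ , refl) , _ , () , _) _) | accSchema refl
  att⇒attack (derive (_ , (_ , _ , _ , refl) , _ , () , _) _) | argSchema _ refl
  att⇒attack {ys = ys} (derive (_ , (_ , _ , σ , refl) , _ , hd , _) _) | attSchema (S , β) e∈ refl
    with elemsS≡ys , refl ←
           ∷ʳ-injective (elems S) ys (cong proj₂ (trans (sym (attFact-inst σ (elems S) β)) hd)) =
    S , e∈ , elemsS≡ys

  attack⇒att : ∀ {I S x} → (S , x) ∈ attacks F → M I (att (length (elems S)) , elems S ++ x ∷ [])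
  attack⇒att {S = S} {x} e∈ =
    derive (_ , (attFact k F (S , x) , attFact∈Π e∈ , (λ ()) , refl) ,
               [] , attFact-inst (λ ()) (elems S) x , refl) []

  acc⇔undefeated : ∀ {I} x → AccIn I x ⇔ (¬ I (def , x ∷ []))
  acc⇔undefeated {I} x = mk⇔ acc⇒undefeated undefeated⇒acc
    where
    acc⇒undefeated : AccIn I x → ¬ I (def , x ∷ [])
    acc⇒undefeated (derive (_ , (_ , R∈ , _) , _) _) with schema R∈
    acc⇒undefeated (derive (_ , (_ , _ , _ , refl) , _ , () , _) _) | defSchema _ refl
    acc⇒undefeated (derive (_ , (_ , _ , _ , refl) , ¬def ∷ [] , refl , _) _) | accSchema refl = ¬def
    acc⇒undefeated (derive (_ , (_ , _ , _ , refl) , _ , () , _) _) | argSchema _ refl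
    acc⇒undefeated (derive (_ , (_ , _ , _ , refl) , _ , () , _) _) | attSchema _ _ refl

    argFact-derived : M I (arg , x ∷ [])
    argFact-derived = derive (_ , (argFact k F x , argFact∈Π x , (λ ()) , refl) , [] , refl , refl) []

    undefeated⇒acc : ¬ I (def , x ∷ []) → AccIn I x
    undefeated⇒acc ¬def =
      derive (_ , (accRule k F , accRule∈Π , (λ _ → x) , refl) , ¬def ∷ [] , refl , refl) (argFact-derived ∷ [])

  accPremises⇔ : ∀ {I i} (σ : Fin (suc i) → Fin n) →
    All (M I) (map (substA σ) (accPremises i)) ⇔ All (AccIn I) (map (σ ∘ suc) (allFin i))
  accPremises⇔ {i = i} σ = mk⇔
    (λ ps → AllP.map⁺ (AllP.map⁻ {xs = allFin i} (AllP.map⁻ {xs = accPremises i} ps)))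
    (λ ps → AllP.map⁺ {xs = accPremises i} (AllP.map⁺ {xs = allFin i} (AllP.map⁻ ps)))

  defRule-fired : ∀ {I i} (σ : Fin (suc i) → Fin n) → M I (substA σ (attPremise i)) →
    All (AccIn I) (map (σ ∘ suc) (allFin i)) → plus F (AccIn I) (σ zero)
  defRule-fired {I} σ attM accepted
    with S , S⇝ , elemsS≡ ← att⇒attack (subst (M I) (attPremise-inst σ) attM) =
    S , S⇝ , λ z z∈S → All.lookup accepted (subst (z ∈_) elemsS≡ (∈ₛ⇒∈elems z∈S))

  defRule-fires : ∀ {I x} y ys → length (y ∷ ys) ≤ k → M I (att (length (y ∷ ys)) , (y ∷ ys) ++ x ∷ []) →
    All (AccIn I) (y ∷ ys) → M I (def , x ∷ [])
  defRule-fires {I} {x} y ys len≤k attM accepted =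
    derive (_ , (defRule k F (suc (length ys)) , defRule∈Π len≤k , σ , refl) , [] , refl , refl)
           (subst (M I) (sym attPremise≡) attM ∷
            from (accPremises⇔ σ) (subst (All (AccIn I)) (sym args≡) accepted))
    where
    σ : Fin (suc (suc (length ys))) → Fin n
    σ zero    = x
    σ (suc j) = llookup (y ∷ ys) j
    args≡ : map (σ ∘ suc) (allFin (suc (length ys))) ≡ y ∷ ys
    args≡ = trans (map-tabulate (λ j → j) (σ ∘ suc)) (tabulate-lookup (y ∷ ys))
    attPremise≡ : substA σ (attPremise (suc (length ys))) ≡ (att (suc (length ys)) , (y ∷ ys) ++ x ∷ [])
    attPremise≡ = trans (attPremise-inst σ) (cong (λ zs → att (suc (length ys)) , zs ++ x ∷ []) args≡)

  def⇔attacked : ∀ {I} x → M I (def , x ∷ []) ⇔ plus F (AccIn I) x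
  def⇔attacked {I} x = mk⇔ def⇒attacked attacked⇒def
    where
    def⇒attacked : M I (def , x ∷ []) → plus F (AccIn I) x
    def⇒attacked (derive (_ , (_ , R∈ , _) , _) _) with schema R∈
    def⇒attacked (derive (_ , (_ , _ , σ , refl) , _ , refl , refl) (attM ∷ accMs)) | defSchema _ refl =
      defRule-fired σ attM (to (accPremises⇔ σ) accMs)
    def⇒attacked (derive (_ , (_ , _ , _ , refl) , _ , () , _) _) | accSchema refl
    def⇒attacked (derive (_ , (_ , _ , _ , refl) , _ , () , _) _) | argSchema _ refl
    def⇒attacked (derive (_ , (_ , _ , _ , refl) , _ , () , _) _) | attSchema _ _ refl

    attacked⇒def : plus F (AccIn I) x → M I (def , x ∷ [])
    attacked⇒def (S , S⇝x , S-accepted) with elems S in elemsS≡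
    ... | [] = ⊥-elim (∉[] (subst (_ ∈_) elemsS≡ (∈ₛ⇒∈elems (proj₂ (nonempty F S⇝x)))))
    ... | y ∷ ys = defRule-fires y ys
      (subst (_≤ k) (trans (sym (length-elems S)) (cong length elemsS≡)) (kF S⇝x))
      (subst (λ zs → M I (att (length zs) , zs ++ x ∷ [])) elemsS≡ (attack⇒att S⇝x))
      (subst (All (AccIn I)) elemsS≡ (All.tabulate (λ z∈ → S-accepted _ (∈elems⇒∈ₛ z∈))))

  Acc Def : ℕ → ArgSet n
  Acc j x = Iseq Π j (acc , x ∷ [])
  Def j x = Iseq Π j (def , x ∷ [])

  -- Def j = (Acc j)⁺; at j = 0 both are empty since attacker sets are nonempty.
  def⇔plus : ∀ j x → Def j x ⇔ plus F (Acc j) x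
  def⇔plus zero    x = mk⇔ (λ ()) (λ (T , T⇝x , T⊆∅) → T⊆∅ _ (proj₂ (nonempty F T⇝x)))
  def⇔plus (suc j) x = def⇔attacked x

  def? : ∀ j → Decidable (Def j)
  def? zero    _ = no (λ ())
  def? (suc j) x = Dec.map (⇔.sym (def⇔plus (suc j) x))
    (plus? (λ z → Dec.map (⇔.sym (acc⇔undefeated z)) (¬? (def? j z))) x)

  -- Two steps of the alternating fixpoint apply Γ once to the accepted arguments;
  -- the forward direction needs def? to find a counter-attacker classically.
  acc-step : ∀ j α → Acc (suc (suc j)) α ⇔ Γ F (Acc j) α
  acc-step j α = mk⇔ acc⇒defended defended⇒acc
    where
    acc⇒defended : Acc (suc (suc j)) α → Γ F (Acc j) α
    acc⇒defended a T T⇝α with any? (λ x → x ∈? T ×-dec def? j x)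
    ... | yes (x , x∈T , d) = x , x∈T , to (def⇔plus j x) d
    ... | no  ¬counter = ⊥-elim (to (acc⇔undefeated α) a
      (from (def⇔plus (suc j) α) (T , T⇝α , λ w w∈T → from (acc⇔undefeated w) (λ d → ¬counter (w , w∈T , d)))))

    defended⇒acc : Γ F (Acc j) α → Acc (suc (suc j)) α
    defended⇒acc γ = from (acc⇔undefeated α) λ d →
      let T , T⇝α , T-accepted = to (def⇔plus (suc j) α) d
          x , x∈T , x∈Acc⁺     = γ T T⇝α
      in  to (acc⇔undefeated x) (T-accepted x x∈T) (from (def⇔plus j x) x∈Acc⁺)

  acc-iterates : ∀ j α → Acc (2 * j) α ⇔ Γ^ j α
  acc-iterates zero    α = mk⇔ (λ ()) (λ ())
  acc-iterates (suc j) α = subst (λ m → Acc m α ⇔ Γ^ (suc j) α) (sym (*-suc 2 j))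
    (⇔.trans (acc-step (2 * j) α) (Γ-cong (acc-iterates j) α))

mainTheorem9 : ∀ {n} (k : ℕ) (F : SETAF n) → IsKSETAF k F →
    (G : ArgSet n) → IsGroundedExt F G →
    ∀ (α : Fin n) → G α ⇔ LP.WFTrue Sym (Fin n) (setafProgram k F) (acc , α ∷ [])
mainTheorem9 k F kF G grounded α =
  ⇔.trans (grounded-as-iterates grounded α)
          (mk⇔ (λ (j , γ) → j , from (acc-iterates j α) γ) (λ (j , a) → j , to (acc-iterates j α) a))
  where
  open Grounded F
  open Encoding k F kF
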